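{- Let $T$ be a complete tree with root $r$ which is not a full tree, and let $u$ be a surficial vertex of $T$. If $Sub_T(u)$ does not belong to $\mathcal{F}_1\cup\mathcal{F}_2\cup\mathcal{F}_3\cup\mathcal{F}_4$, then $\chi'_{CF}(T)=3$.
   Context: A complete tree is a rooted tree whose root $r$ has degree $1$ and in which every non-root vertex with at least one son has at least two sons. Edges are oriented away from $r$; $x^+$ is the father of a non-root vertex $x$; levels in $T$ are distances from $r$. For a non-root vertex $v$, $Sub_T(v)$ is the subtree induced by $v^+$, $v$ and all descendants of $v$, rooted at $v^+$. $Sub_T(v)$ is a full tree if, for some $m\ge1$, all its vertices other than $v^+$ with no sons lie at distance $m$ from $v^+$ and every vertex at distance $1,\dots,m-1$ from $v^+$ has at least two sons; its level is $\ell(Sub_T(v))=m+1$. $T$ is a full tree if $Sub_T(w)$ is full for the unique son $w$ of $r$. $Sub_T(v)$ is a maximal full subtree if it is full, $v^+\ne r$, and $Sub_T(v^+)$ is not full. Let $I=\{x^+: Sub_T(x)\text{ is a maximal full subtree}\}$; a surficial vertex is a vertex of $I$ of maximum level in $T$. The families: $Sub_T(u)\in\mathcal{F}_j$ means that $Sub_T(w)$ is a full tree for every son $w$ of $u$ and, writing $n_k$ for the number of sons $w$ of $u$ with $\ell(Sub_T(w))=k$: $\mathcal{F}_1$: $n_2>0$, $n_3=1$, and no other levels occur; $\mathcal{F}_2$: $n_2>0$, $n_4>0$, and no other levels occur; $\mathcal{F}_3$: $n_2\ge 0$, $n_3=1$, $n_4>0$, and no other levels occur; $\mathcal{F}_4$: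 $n_5=1$, $n_2+n_4>0$, and no other levels occur. The conflict-free chromatic index $\chi'_{CF}(G)$ is the least $k$ such that $G$ has an edge-coloring with $k$ colors in which every edge $e=xy$ has a color appearing on exactly one edge of $E(x)\cup E(y)$, where $E(x)$ denotes the set of edges incident with $x$. -}

module Defs where

open import Data.Nat using (ℕ; zero; suc; _≤_; _<_)
open import Data.Fin using (Fin)
open import Data.Product using (Σ; ∃; _×_; _,_)
open import Data.Sum using (_⊎_)
open import Relation.Binary.PropositionalEquality using (_≡_; _≢_)
open import Relation.Nullary using (¬_)

data Tree : Set where
  node : (n : ℕ) → (Fin n → Tree) → Tree

arity : Tree → ℕ
arity (node n _) = n

-- vertices of a tree, as positions (paths from the root)
data Pos : Tree → Set where
  here  : ∀ {t} → Pos t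
  there : ∀ {n f} (i : Fin n) → Pos (f i) → Pos (node n f)

sub : (t : Tree) → Pos t → Tree
sub t here = t
sub (node n f) (there i p) = sub (f i) p

depth : ∀ {t} → Pos t → ℕ
depth here = zero
depth (there i p) = suc (depth p)

child : ∀ {t} (p : Pos t) → Fin (arity (sub t p)) → Pos t
child {node n f} here i = there i here
child {node n f} (there i p) j = there i (child p j)

-- edges: (father p, index i of the son); the edge joins p and child p i
Edge : Tree → Set
Edge t = Σ (Pos t) (λ p → Fin (arity (sub t p)))

Incident : ∀ {t} → Edge t → Pos t → Set
Incident (p , i) v = v ≡ p ⊎ v ≡ child p i

-- conflict-free edge colouring: for each edge e = xy some colour appears on
-- exactly one edge of E(x) ∪ E(y)
IsCFColoring : (t : Tree) (k : ℕ) → (Edge t → Fin k) → Set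
IsCFColoring t k c =
  (e : Edge t) →
  let (p , i) = e in
  Σ (Edge t) λ g →
    (Incident g (child p i) ⊎ Incident g p) ×
    ((g′ : Edge t) → (Incident g′ (child p i) ⊎ Incident g′ p) → c g′ ≡ c g → g′ ≡ g)

HasCFColoring : Tree → ℕ → Set
HasCFColoring t k = Σ (Edge t → Fin k) (IsCFColoring t k)

CFChromaticIndexIs : Tree → ℕ → Set
CFChromaticIndexIs t k = HasCFColoring t k × ((j : ℕ) → j < k → ¬ HasCFColoring t j)

Complete : Tree → Set
Complete t = arity t ≡ 1 ×
  ((p : Pos t) → p ≢ here → arity (sub t p) ≡ 0 ⊎ 2 ≤ arity (sub t p))

-- Sub_T(v): v^+ together with v and its descendants, rooted at v^+
-- (for v a non-root vertex; v^+ becomes a root with the single son v)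
SubT : (t : Tree) → Pos t → Tree
SubT t v = node 1 (λ _ → sub t v)

FullWith : Tree → ℕ → Set
FullWith s m = 1 ≤ m ×
  ((q : Pos s) → q ≢ here → arity (sub s q) ≡ 0 → depth q ≡ m) ×
  ((q : Pos s) → 1 ≤ depth q → depth q < m → 2 ≤ arity (sub s q))

Full : Tree → Set
Full s = ∃ (FullWith s)

Level : Tree → ℕ → Set
Level s l = Σ ℕ λ m → FullWith s m × l ≡ suc m

FullTree : Tree → Set
FullTree t = (i : Fin (arity t)) → Full (SubT t (child here i))

MaxFull : (t : Tree) (p : Pos t) → Fin (arity (sub t p)) → Set
MaxFull t p i = Full (SubT t (child p i)) × p ≢ here × ¬ Full (SubT t p)

InI : (t : Tree) → Pos t → Set
InI t u = Σ (Fin (arity (sub t u))) (MaxFull t u)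

Surficial : (t : Tree) → Pos t → Set
Surficial t u = InI t u × ((u′ : Pos t) → InI t u′ → depth u′ ≤ depth u)

SonLevel : (t : Tree) (u : Pos t) → Fin (arity (sub t u)) → ℕ → Set
SonLevel t u j k = Level (SubT t (child u j)) k

AllSonsFull : (t : Tree) → Pos t → Set
AllSonsFull t u = (j : Fin (arity (sub t u))) → Full (SubT t (child u j))

SomeSon : (t : Tree) → Pos t → ℕ → Set
SomeSon t u k = Σ (Fin (arity (sub t u))) λ j → SonLevel t u j k

ExactlyOneSon : (t : Tree) → Pos t → ℕ → Set
ExactlyOneSon t u k = Σ (Fin (arity (sub t u))) λ j → SonLevel t u j k ×
  ((j′ : Fin (arity (sub t u))) → SonLevel t u j′ k → j′ ≡ j)

InF1 : (t : Tree) → Pos t → Set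
InF1 t u = AllSonsFull t u × SomeSon t u 2 × ExactlyOneSon t u 3 ×
  ((j : Fin (arity (sub t u))) → SonLevel t u j 2 ⊎ SonLevel t u j 3)

InF2 : (t : Tree) → Pos t → Set
InF2 t u = AllSonsFull t u × SomeSon t u 2 × SomeSon t u 4 ×
  ((j : Fin (arity (sub t u))) → SonLevel t u j 2 ⊎ SonLevel t u j 4)

InF3 : (t : Tree) → Pos t → Set
InF3 t u = AllSonsFull t u × ExactlyOneSon t u 3 × SomeSon t u 4 ×
  ((j : Fin (arity (sub t u))) → SonLevel t u j 2 ⊎ SonLevel t u j 3 ⊎ SonLevel t u j 4)

InF4 : (t : Tree) → Pos t → Set
InF4 t u = AllSonsFull t u × ExactlyOneSon t u 5 × (SomeSon t u 2 ⊎ SomeSon t u 4) ×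
  ((j : Fin (arity (sub t u))) → SonLevel t u j 2 ⊎ SonLevel t u j 4 ⊎ SonLevel t u j 5)

{-# OPTIONS --safe #-}
-- Lower bound: fix a conflict-free 2-coloring. Inside full subtrees the coloring is forced
-- into a rigid pattern: a vertex of height 1 has a uniquely colored incident edge, all edges
-- at a vertex of height 2 share one color, the edges below a vertex of height 3 all differ in
-- color from the edge above it, and height 4 is impossible. All sons of a surficial vertex u
-- head full subtrees (a non-full son would lead to a deeper vertex of I), and these patterns
-- restrict their levels to F₁–F₄ unless all sons have one level, which makes Sub_T(u) full.
-- Upper bound: color each edge by the depth of its upper end modulo 3.
module Submission where

open import Defs
open import Data.Empty using (⊥; ⊥-elim)
open import Data.Fin using (Fin; zero; suc; inject≤)
open import Data.Fin.Properties using (all?; any?; ¬∀⟶∃¬; inject≤-injective; ¬Fin0)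
open import Data.Maybe using (Maybe; just; nothing)
open import Data.Maybe.Properties using (just-injective)
open import Data.Nat using (ℕ; zero; suc; _+_; _≤_; _<_; z≤n; s≤s; _≤?_)
open import Data.Nat.Properties using (suc-injective; ≤-refl; ≤-trans; n≤1+n; 1+n≰n)
import Data.Nat.Properties as ℕ
open import Data.Product using (Σ; ∃; _×_; _,_; proj₁; proj₂)
open import Data.Sum using (_⊎_; inj₁; inj₂; swap)
import Data.Sum as Sum
open import Function using (_∋_; _∘_)
import Data.Fin as Fin
open import Relation.Binary.PropositionalEquality using (_≡_; _≢_; refl; sym; trans; cong; subst)
open import Relation.Nullary using (¬_; Dec; yes; no)
open import Relation.Nullary.Decidable using (map′; _×-dec_)

son : (t : Tree) → Fin (arity t) → Tree
son (node _ f) = f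

depth-child : ∀ {t} (p : Pos t) i → depth (child p i) ≡ suc (depth p)
depth-child {node _ _} here        i = refl
depth-child {node _ _} (there j p) i = cong suc (depth-child p i)

sub-child : ∀ {t} (p : Pos t) i → sub t (child p i) ≡ son (sub t p) i
sub-child {node _ _} here        i = refl
sub-child {node _ _} (there j p) i = sub-child p i

child≢here : ∀ {t} (p : Pos t) i → child p i ≢ here
child≢here p i eq with trans (sym (depth-child p i)) (cong depth eq)
... | ()

parent : ∀ {t} → Pos t → Maybe (Edge t)
parent here = nothing
parent (there i p) with parent p
... | nothing      = just (here , i)
... | just (q , k) = just (there i q , k)

parent-child : ∀ {t} (p : Pos t) i → parent (child p i) ≡ just (p , i)
parent-child {node _ _} here        i = refl
parent-child {node _ _} (there j p) i rewrite parent-child p i = refl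

child-injective : ∀ {t} {p q : Pos t} {i j} → child p i ≡ child q j → (Edge t ∋ (p , i)) ≡ (q , j)
child-injective {p = p} {q} {i} {j} eq =
  just-injective (trans (sym (parent-child p i)) (trans (cong parent eq) (parent-child q j)))

here-or-child : ∀ {t} (p : Pos t) → p ≡ here ⊎ Σ (Edge t) λ (q , k) → child q k ≡ p
here-or-child here = inj₁ refl
here-or-child (there i p) with here-or-child p
... | inj₁ refl              = inj₂ ((here , i) , refl)
... | inj₂ ((q , k) , refl) = inj₂ ((there i q , k) , refl)

FullOfHeight : Tree → ℕ → Set
FullOfHeight t zero    = arity t ≡ 0
FullOfHeight t (suc h) = 2 ≤ arity t × ((i : Fin (arity t)) → FullOfHeight (son t i) h)

LeavesAt : Tree → ℕ → Set
LeavesAt t h = (q : Pos t) → arity (sub t q) ≡ 0 → depth q ≡ h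

BranchingBelow : Tree → ℕ → Set
BranchingBelow t h = (q : Pos t) → depth q < h → 2 ≤ arity (sub t q)

some-leaf : (t : Tree) → Σ (Pos t) λ q → arity (sub t q) ≡ 0
some-leaf (node zero    f) = here , refl
some-leaf (node (suc n) f) with some-leaf (f zero)
... | q , q-leaf = there zero q , q-leaf

fullOfHeight⇒leavesAt : ∀ t h → FullOfHeight t h → LeavesAt t h
fullOfHeight⇒leavesAt t          zero    _        here        _    = refl
fullOfHeight⇒leavesAt (node n f) zero    refl     (there () q)
fullOfHeight⇒leavesAt t          (suc h) (2≤ , _) here        q-leaf = ⊥-elim (ℕ.m<n⇒n≢0 2≤ q-leaf)
fullOfHeight⇒leavesAt (node n f) (suc h) (_ , F)  (there i q) q-leaf =
  cong suc (fullOfHeight⇒leavesAt (f i) h (F i) q q-leaf)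

fullOfHeight⇒branchingBelow : ∀ t h → FullOfHeight t h → BranchingBelow t h
fullOfHeight⇒branchingBelow t          (suc h) (2≤ , _) here        _ = 2≤
fullOfHeight⇒branchingBelow (node n f) (suc h) (_ , F)  (there i q) (s≤s d<h) =
  fullOfHeight⇒branchingBelow (f i) h (F i) q d<h

leavesAt⇒fullOfHeight : ∀ t h → LeavesAt t h → BranchingBelow t h → FullOfHeight t h
leavesAt⇒fullOfHeight (node zero f) h L _ with L here refl
... | refl = refl
leavesAt⇒fullOfHeight (node (suc n) f) zero L _ with some-leaf (f zero)
... | q , q-leaf with L (there zero q) q-leaf
... | ()
leavesAt⇒fullOfHeight (node (suc n) f) (suc h) L B =
  B here (s≤s z≤n) ,
  λ i → leavesAt⇒fullOfHeight (f i) h (λ q q-leaf → suc-injective (L (there i q) q-leaf))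
                                      (λ q d<h → B (there i q) (s≤s d<h))

fullOfHeight-unique : ∀ {t h h′} → FullOfHeight t h → FullOfHeight t h′ → h ≡ h′
fullOfHeight-unique {t} {h} {h′} F F′ with some-leaf t
... | q , q-leaf =
  trans (sym (fullOfHeight⇒leavesAt t h F q q-leaf)) (fullOfHeight⇒leavesAt t h′ F′ q q-leaf)

fullOfHeight? : ∀ t h → Dec (FullOfHeight t h)
fullOfHeight? t zero    = arity t ℕ.≟ 0
fullOfHeight? t (suc h) = 2 ≤? arity t ×-dec all? (λ i → fullOfHeight? (son t i) h)

height? : ∀ t → Dec (∃ (FullOfHeight t))
height? t with some-leaf t
... | q , q-leaf = map′ (depth q ,_) at-depth-q (fullOfHeight? t (depth q))
  where
  at-depth-q : ∃ (FullOfHeight t) → FullOfHeight t (depth q)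
  at-depth-q (h , F) = subst (FullOfHeight t) (sym (fullOfHeight⇒leavesAt t h F q q-leaf)) F

Planted : Tree → Tree
Planted t = node 1 (λ _ → t)

fullWith⇒fullOfHeight : ∀ {t h} → FullWith (Planted t) (suc h) → FullOfHeight t h
fullWith⇒fullOfHeight {t} {h} (_ , L , B) =
  leavesAt⇒fullOfHeight t h (λ q q-leaf → suc-injective (L (there zero q) (λ ()) q-leaf))
                            (λ q d<h → B (there zero q) (s≤s z≤n) (s≤s d<h))

fullOfHeight⇒fullWith : ∀ {t h} → FullOfHeight t h → FullWith (Planted t) (suc h)
fullOfHeight⇒fullWith {t} {h} F = s≤s z≤n , L , B
  where
  L : (q : Pos (Planted t)) → q ≢ here → arity (sub (Planted t) q) ≡ 0 → depth q ≡ suc h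
  L here         q≢here _      = ⊥-elim (q≢here refl)
  L (there zero q) _     q-leaf = cong suc (fullOfHeight⇒leavesAt t h F q q-leaf)
  B : (q : Pos (Planted t)) → 1 ≤ depth q → depth q < suc h → 2 ≤ arity (sub (Planted t) q)
  B (there zero q) _ (s≤s d<h) = fullOfHeight⇒branchingBelow t h F q d<h

full⇒height : ∀ {t} → Full (Planted t) → ∃ (FullOfHeight t)
full⇒height (suc h , F) = h , fullWith⇒fullOfHeight F

height⇒full : ∀ {t} → ∃ (FullOfHeight t) → Full (Planted t)
height⇒full (h , F) = suc h , fullOfHeight⇒fullWith F

full? : ∀ t → Dec (Full (Planted t))
full? t = map′ height⇒full full⇒height (height? t)

leaf-or-son : ∀ t → arity t ≡ 0 ⊎ Fin (arity t)
leaf-or-son (node zero    _) = inj₁ refl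
leaf-or-son (node (suc n) _) = inj₂ zero

son-subst : ∀ {s s′} (eq : s ≡ s′) i → son s i ≡ son s′ (subst (λ t → Fin (arity t)) eq i)
son-subst refl i = refl

module _ (T : Tree) where

  nonFull⇒I-below : ∀ t (x : Pos T) → sub T x ≡ t → x ≢ here → ¬ Full (SubT T x) →
                    Σ (Pos T) λ u → InI T u × depth x ≤ depth u
  nonFull⇒I-below (node n f) x eq x≢here ¬full with all? (λ j → full? (sub T (child x j)))
  ... | yes sons-full with leaf-or-son (sub T x)
  ...   | inj₁ x-leaf = ⊥-elim (¬full (height⇒full (0 , x-leaf)))
  ...   | inj₂ j      = x , (j , sons-full j , x≢here , ¬full) , ≤-refl
  nonFull⇒I-below (node n f) x eq x≢here ¬full | no ¬sons-full
    with ¬∀⟶∃¬ _ _ (λ j → full? (sub T (child x j))) ¬sons-full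
  ... | j , ¬full-j
    with nonFull⇒I-below (f (subst (λ t → Fin (arity t)) eq j)) (child x j)
           (trans (sub-child x j) (son-subst eq j)) (child≢here x j) ¬full-j
  ... | u , u∈I , child≤u = u , u∈I , ≤-trans (n≤1+n _) (subst (_≤ depth u) (depth-child x j) child≤u)

  surficial⇒sonsFull : ∀ {u} → Surficial T u → AllSonsFull T u
  surficial⇒sonsFull {u} (_ , deepest) j with full? (sub T (child u j))
  ... | yes full = full
  ... | no ¬full with nonFull⇒I-below _ (child u j) refl (child≢here u j) ¬full
  ... | u′ , u′∈I , child≤u′ =
    ⊥-elim (1+n≰n (≤-trans (subst (_≤ depth u′) (depth-child u j) child≤u′) (deepest u′ u′∈I)))

mod3 : ℕ → Fin 3
mod3 0                   = zero
mod3 1                   = suc zero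
mod3 2                   = suc (suc zero)
mod3 (suc (suc (suc n))) = mod3 n

mod3-suc≢ : ∀ n → mod3 (suc n) ≢ mod3 n
mod3-suc≢ 0                   ()
mod3-suc≢ 1                   ()
mod3-suc≢ 2                   ()
mod3-suc≢ (suc (suc (suc n))) = mod3-suc≢ n

mod3-suc-suc≢ : ∀ n → mod3 (suc (suc n)) ≢ mod3 n
mod3-suc-suc≢ 0                   ()
mod3-suc-suc≢ 1                   ()
mod3-suc-suc≢ 2                   ()
mod3-suc-suc≢ (suc (suc (suc n))) = mod3-suc-suc≢ n

Fin1-unique : ∀ {n} → n ≡ 1 → (a b : Fin n) → a ≡ b
Fin1-unique refl zero zero = refl

depthColoring : ∀ t → Edge t → Fin 3
depthColoring t (p , _) = mod3 (depth p)

-- Among the edges at p and at child p i, the edge above p is the only one colored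
-- mod3 (depth p ∸ 1); when p is the root, the root edge is the only one colored 0.
depthColoring-cf : ∀ t → arity t ≡ 1 → IsCFColoring t 3 (depthColoring t)
depthColoring-cf t root-arity (p , i) with here-or-child p
... | inj₁ refl = (here , i) , inj₂ (inj₁ refl) , unique
  where
  unique : ∀ g → Incident g (child here i) ⊎ Incident g here → mod3 (depth (proj₁ g)) ≡ mod3 0 →
           g ≡ (here , i)
  unique (q , k) (inj₁ (inj₁ refl)) same =
    ⊥-elim (mod3-suc≢ 0 (trans (cong mod3 (sym (depth-child {t} here i))) same))
  unique (q , k) (inj₁ (inj₂ eq))   _    = sym (child-injective eq)
  unique (q , k) (inj₂ (inj₁ refl)) _    = cong (here ,_) (Fin1-unique root-arity k i)
  unique (q , k) (inj₂ (inj₂ eq))   _    = ⊥-elim (child≢here q k (sym eq))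
... | inj₂ ((q₀ , k₀) , refl) = (q₀ , k₀) , inj₂ (inj₂ refl) , unique
  where
  depth-p : depth p ≡ suc (depth q₀)
  depth-p = depth-child q₀ k₀
  color-p : mod3 (depth p) ≡ mod3 (suc (depth q₀))
  color-p = cong mod3 depth-p
  unique : ∀ g → Incident g (child p i) ⊎ Incident g p → mod3 (depth (proj₁ g)) ≡ mod3 (depth q₀) →
           g ≡ (q₀ , k₀)
  unique (q , k) (inj₁ (inj₁ refl)) same =
    ⊥-elim (mod3-suc-suc≢ (depth q₀)
             (trans (cong mod3 (sym (trans (depth-child p i) (cong suc depth-p)))) same))
  unique (q , k) (inj₁ (inj₂ eq))   same with child-injective eq
  ... | refl = ⊥-elim (mod3-suc≢ (depth q₀) (trans (sym color-p) same))
  unique (q , k) (inj₂ (inj₁ refl)) same = ⊥-elim (mod3-suc≢ (depth q₀) (trans (sym color-p) same))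
  unique (q , k) (inj₂ (inj₂ eq))   _    = sym (child-injective eq)

hasCFColoring-mono : ∀ {t m n} → m ≤ n → HasCFColoring t m → HasCFColoring t n
hasCFColoring-mono m≤n (c , cf) = (λ e → inject≤ (c e) m≤n) , λ e →
  let (g , g∈N , unique) = cf e
  in  g , g∈N , λ g′ g′∈N same → unique g′ g′∈N (inject≤-injective m≤n m≤n _ _ same)

two-sons : ∀ {n} → 2 ≤ n → Σ (Fin n) λ j₀ → Σ (Fin n) λ j₁ → j₀ ≢ j₁
two-sons (s≤s (s≤s _)) = zero , suc zero , λ ()

fullOfHeight-son : ∀ {t} (x : Pos t) {h} → FullOfHeight (sub t x) (suc h) →
                   ∀ j → FullOfHeight (sub t (child x j)) h
fullOfHeight-son {t} x {h} (_ , F) j = subst (λ s → FullOfHeight s h) (sym (sub-child x j)) (F j)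

depth-<-child : ∀ {t} (x : Pos t) j → depth x < depth (child x j)
depth-<-child x j = subst (depth x <_) (sym (depth-child x j)) (ℕ.n<1+n _)

fin2-≢-≢⇒≡ : {a b d : Fin 2} → a ≢ d → b ≢ d → a ≡ b
fin2-≢-≢⇒≡ {zero}      {zero}      _   _   = refl
fin2-≢-≢⇒≡ {suc zero}  {suc zero}  _   _   = refl
fin2-≢-≢⇒≡ {zero}      {suc zero}  {zero}      a≢d _   = ⊥-elim (a≢d refl)
fin2-≢-≢⇒≡ {zero}      {suc zero}  {suc zero}  _   b≢d = ⊥-elim (b≢d refl)
fin2-≢-≢⇒≡ {suc zero}  {zero}      {zero}      _   b≢d = ⊥-elim (b≢d refl)
fin2-≢-≢⇒≡ {suc zero}  {zero}      {suc zero}  a≢d _   = ⊥-elim (a≢d refl)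

fin2-pigeonhole : (a b d : Fin 2) → a ≡ b ⊎ a ≡ d ⊎ b ≡ d
fin2-pigeonhole a b d with a Fin.≟ b | a Fin.≟ d
... | yes a≡b | _       = inj₁ a≡b
... | no _    | yes a≡d = inj₂ (inj₁ a≡d)
... | no a≢b  | no a≢d  = inj₂ (inj₂ (fin2-≢-≢⇒≡ (a≢b ∘ sym) (a≢d ∘ sym)))

module TwoColoring (T : Tree) (c : Edge T → Fin 2) (cf : IsCFColoring T 2 c) where

  E : Pos T → Edge T → Set
  E x g = Incident g x

  N : Edge T → Edge T → Set
  N (p , i) g = E (child p i) g ⊎ E p g

  Unique : (Edge T → Set) → Edge T → Set
  Unique P g = P g × (∀ g′ → P g′ → c g′ ≡ c g → g′ ≡ g)

  Repeated : (Edge T → Set) → Fin 2 → Set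
  Repeated P α = Σ (Edge T) λ a → Σ (Edge T) λ a′ → P a × P a′ × a ≢ a′ × c a ≡ α × c a′ ≡ α

  son∈E : ∀ x j → E x (x , j)
  son∈E x j = inj₁ refl

  parent∈E : ∀ p i → E (child p i) (p , i)
  parent∈E p i = inj₂ refl

  E-child-cases : ∀ {p i g} → E (child p i) g →
                  g ≡ (p , i) ⊎ Σ (Fin (arity (sub T (child p i)))) λ l → g ≡ (child p i , l)
  E-child-cases {g = q , k} (inj₁ refl) = inj₂ (k , refl)
  E-child-cases             (inj₂ eq)   = inj₁ (sym (child-injective eq))

  sonEdge∉E-parent : ∀ x j l → ¬ E x (child x j , l)
  sonEdge∉E-parent x j l (inj₁ eq) = ℕ.<⇒≢ (depth-<-child x j) (cong depth eq)
  sonEdge∉E-parent x j l (inj₂ eq) =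
    ℕ.<⇒≢ (ℕ.<-trans (depth-<-child x j) (depth-<-child (child x j) l)) (cong depth eq)

  parentEdge≢sonEdge : ∀ p i j → (Edge T ∋ (p , i)) ≢ (child p i , j)
  parentEdge≢sonEdge p i j eq = ℕ.<⇒≢ (depth-<-child p i) (cong (depth ∘ proj₁) eq)

  sonEdge-injective : ∀ {x} {j j′ : Fin (arity (sub T x))} → (Edge T ∋ (x , j)) ≡ (x , j′) → j ≡ j′
  sonEdge-injective refl = refl

  unique-color≢ : ∀ {P g α} → Unique P g → Repeated P α → c g ≢ α
  unique-color≢ (_ , only) (a , a′ , a∈ , a′∈ , a≢a′ , ca , ca′) cg≡α =
    a≢a′ (trans (only a a∈ (trans ca (sym cg≡α))) (sym (only a′ a′∈ (trans ca′ (sym cg≡α)))))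

  other-color-unique : ∀ {P α b} → ∃ (Unique P) → Repeated P α → P b → c b ≢ α → Unique P b
  other-color-unique (g , g-unique) rep b∈ cb≢α = b∈ , λ g′ g′∈ cg′≡cb →
    let cb≡cg = fin2-≢-≢⇒≡ cb≢α (unique-color≢ g-unique rep)
    in  trans (proj₂ g-unique g′ g′∈ (trans cg′≡cb cb≡cg)) (sym (proj₂ g-unique _ b∈ cb≡cg))

  unique-restrictʳ : ∀ {P Q : Edge T → Set} {g} → Unique (λ h → P h ⊎ Q h) g → Q g → Unique Q g
  unique-restrictʳ (_ , only) g∈Q = g∈Q , λ g′ g′∈Q → only g′ (inj₂ g′∈Q)

  unique⇒both-colors : ∀ {P g a a′ β} → Unique P g → P a → P a′ → a ≢ a′ →
                        (∀ {h} → P h → c h ≢ β) → ⊥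
  unique⇒both-colors {g = g} {a} {a′} g-unique a∈ a′∈ a≢a′ avoid =
    unique-color≢ g-unique (a , a′ , a∈ , a′∈ , a≢a′ , refl , fin2-≢-≢⇒≡ (avoid a′∈) (avoid a∈))
      (fin2-≢-≢⇒≡ (avoid (proj₁ g-unique)) (avoid a∈))

  repeated₃ : ∀ {P a b d} → P a → P b → P d → a ≢ b → a ≢ d → b ≢ d → ∃ (Repeated P)
  repeated₃ {a = a} {b} {d} a∈ b∈ d∈ a≢b a≢d b≢d with fin2-pigeonhole (c a) (c b) (c d)
  ... | inj₁ ca≡cb        = c a , a , b , a∈ , b∈ , a≢b , refl , sym ca≡cb
  ... | inj₂ (inj₁ ca≡cd) = c a , a , d , a∈ , d∈ , a≢d , refl , sym ca≡cd
  ... | inj₂ (inj₂ cb≡cd) = c b , b , d , b∈ , d∈ , b≢d , refl , sym cb≡cd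

  branching⇒repeated : ∀ p i {j₀ j₁} → j₀ ≢ j₁ → ∃ (Repeated (E (child p i)))
  branching⇒repeated p i {j₀} {j₁} j₀≢j₁ =
    repeated₃ (parent∈E p i) (son∈E _ j₀) (son∈E _ j₁)
              (parentEdge≢sonEdge p i j₀) (parentEdge≢sonEdge p i j₁) (j₀≢j₁ ∘ sonEdge-injective)

  repeated-⊎ʳ : ∀ {P Q : Edge T → Set} {α} → Repeated Q α → Repeated (λ h → P h ⊎ Q h) α
  repeated-⊎ʳ (a , a′ , a∈ , a′∈ , rest) = a , a′ , inj₂ a∈ , inj₂ a′∈ , rest

  leaf-son⇒unique : ∀ x j → arity (sub T (child x j)) ≡ 0 → ∃ (Unique (E x))
  leaf-son⇒unique x j leaf with cf (x , j)
  ... | g , g∈N , only = g , unique-restrictʳ (g∈N , only) (g∈E g∈N)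
    where
    g∈E : N (x , j) g → E x g
    g∈E (inj₂ g∈) = g∈
    g∈E (inj₁ g∈) with E-child-cases g∈
    ... | inj₁ refl     = son∈E x j
    ... | inj₂ (l , _) = ⊥-elim (¬Fin0 (subst Fin leaf l))

  height1⇒unique : ∀ x → FullOfHeight (sub T x) 1 → ∃ (Unique (E x))
  height1⇒unique x F = leaf-son⇒unique x j (fullOfHeight-son x F j)
    where j = proj₁ (two-sons (proj₁ F))

  height1-son⇒N-unique≡sonEdge : ∀ x j {b} → FullOfHeight (sub T (child x j)) 1 →
                                 E x b → Unique (N (x , j)) b → b ≡ (x , j)
  height1-son⇒N-unique≡sonEdge x j {b} F b∈ (_ , only) with c (x , j) Fin.≟ c b
  ... | yes same   = sym (only (x , j) (inj₂ (son∈E x j)) same)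
  ... | no differ with two-sons (proj₁ F)
  ... | l₀ , l₁ , l₀≢l₁ =
    ⊥-elim (unique⇒both-colors (proj₂ (height1⇒unique z F)) (son∈E z l₀) (son∈E z l₁)
                               (l₀≢l₁ ∘ sonEdge-injective) avoid)
    where
    z = child x j
    avoid : ∀ {h} → E z h → c h ≢ c b
    avoid h∈ with E-child-cases h∈
    ... | inj₁ refl       = differ
    ... | inj₂ (l , refl) = λ same →
      sonEdge∉E-parent x j l (subst (E x) (sym (only _ (inj₁ h∈) same)) b∈)

  height2⇒monochromatic : ∀ p i → FullOfHeight (sub T (child p i)) 2 →
                          ∀ {g} → E (child p i) g → c g ≡ c (p , i)
  height2⇒monochromatic p i F g∈ with two-sons (proj₁ F)
  ... | j₀ , j₁ , j₀≢j₁ with branching⇒repeated p i j₀≢j₁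
  ... | α , rep = trans (colored-α g∈) (sym (colored-α (parent∈E p i)))
    where
    y = child p i
    colored-α : ∀ {b} → E y b → c b ≡ α
    colored-α {b} b∈ with c b Fin.≟ α
    ... | yes same  = same
    ... | no differ = ⊥-elim (j₀≢j₁ (sonEdge-injective (trans (sym (absorbed j₀)) (absorbed j₁))))
      where
      absorbed : ∀ j → b ≡ (y , j)
      absorbed j = height1-son⇒N-unique≡sonEdge y j (fullOfHeight-son y F j) b∈
                     (other-color-unique (cf (y , j)) (repeated-⊎ʳ rep) (inj₂ b∈) differ)

  height2-son⇒repeated : ∀ x j → FullOfHeight (sub T (child x j)) 2 → Repeated (N (x , j)) (c (x , j))
  height2-son⇒repeated x j F with two-sons (proj₁ F)
  ... | l₀ , l₁ , l₀≢l₁ =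
    (z , l₀) , (z , l₁) , inj₁ (son∈E z l₀) , inj₁ (son∈E z l₁) , l₀≢l₁ ∘ sonEdge-injective ,
    height2⇒monochromatic x j F (son∈E z l₀) , height2⇒monochromatic x j F (son∈E z l₁)
    where z = child x j

  height2-son⇒unique : ∀ x j → FullOfHeight (sub T (child x j)) 2 →
                       Σ (Edge T) λ g → Unique (E x) g × c g ≢ c (x , j)
  height2-son⇒unique x j F with cf (x , j)
  ... | g , g∈N , only = g , unique-restrictʳ (g∈N , only) (g∈E g∈N) , cg≢
    where
    cg≢ : c g ≢ c (x , j)
    cg≢ = unique-color≢ (g∈N , only) (height2-son⇒repeated x j F)
    g∈E : N (x , j) g → E x g
    g∈E (inj₁ g∈) = ⊥-elim (cg≢ (height2⇒monochromatic x j F g∈))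
    g∈E (inj₂ g∈) = g∈

  height2-son⇒other-color-unique : ∀ x j {b} → FullOfHeight (sub T (child x j)) 2 →
                                   E x b → c b ≢ c (x , j) → Unique (E x) b
  height2-son⇒other-color-unique x j F b∈ cb≢ =
    unique-restrictʳ (other-color-unique (cf (x , j)) (height2-son⇒repeated x j F) (inj₂ b∈) cb≢) b∈

  height3⇒sons-recolored : ∀ p i → FullOfHeight (sub T (child p i)) 3 → ∀ k → c (child p i , k) ≢ c (p , i)
  height3⇒sons-recolored p i F k same
    with height2-son⇒unique (child p i) k (fullOfHeight-son (child p i) F k)
  ... | g , (g∈ , _) , cg≢ with E-child-cases g∈
  ...   | inj₁ refl       = cg≢ (sym same)
  ...   | inj₂ (l , refl) = parentEdge≢sonEdge p i k (sym (proj₂ pi-unique (child p i , k) (son∈E _ k) same))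
    where
    pi-unique : Unique (E (child p i)) (p , i)
    pi-unique = height2-son⇒other-color-unique (child p i) l (fullOfHeight-son (child p i) F l)
                  (parent∈E p i) (λ eq → cg≢ (trans (sym eq) (sym same)))

  height3-son⇒unique : ∀ x j → FullOfHeight (sub T (child x j)) 3 → Unique (E x) (x , j)
  height3-son⇒unique x j F with two-sons (proj₁ F)
  ... | l₀ , l₁ , l₀≢l₁ =
    unique-restrictʳ (other-color-unique (cf (x , j)) rep (inj₂ (son∈E x j)) (recolored l₀ ∘ sym)) (son∈E x j)
    where
    z = child x j
    recolored = height3⇒sons-recolored x j F
    rep : Repeated (N (x , j)) (c (z , l₀))
    rep = (z , l₀) , (z , l₁) , inj₁ (son∈E z l₀) , inj₁ (son∈E z l₁) , l₀≢l₁ ∘ sonEdge-injective ,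
          refl , fin2-≢-≢⇒≡ (recolored l₁) (recolored l₀)

  uniqueSonEdges-equal : ∀ q k {j₀ j₁} → Unique (E (child q k)) (child q k , j₀) →
                         Unique (E (child q k)) (child q k , j₁) → j₀ ≡ j₁
  uniqueSonEdges-equal q k {j₀} {j₁} (_ , only₀) (_ , only₁)
    with c (child q k , j₀) Fin.≟ c (child q k , j₁) | c (q , k) Fin.≟ c (child q k , j₀)
  ... | yes same   | _        = sonEdge-injective (only₁ _ (son∈E _ j₀) same)
  ... | no differ  | yes same = ⊥-elim (parentEdge≢sonEdge q k j₀ (only₀ (q , k) (parent∈E q k) same))
  ... | no differ  | no other =
    ⊥-elim (parentEdge≢sonEdge q k j₁ (only₁ (q , k) (parent∈E q k) (fin2-≢-≢⇒≡ other (differ ∘ sym))))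

  ¬height≥4 : ∀ p i h → ¬ FullOfHeight (sub T (child p i)) (4 + h)
  ¬height≥4 p i h F with two-sons (proj₁ F)
  ¬height≥4 p i zero    F | j₀ , j₁ , j₀≢j₁ =
    j₀≢j₁ (uniqueSonEdges-equal p i (height3-son⇒unique y j₀ (fullOfHeight-son y F j₀))
                                    (height3-son⇒unique y j₁ (fullOfHeight-son y F j₁)))
    where y = child p i
  ¬height≥4 p i (suc h) F | j₀ , _ , _ = ¬height≥4 (child p i) j₀ h (fullOfHeight-son (child p i) F j₀)

  height1-son⇒sonEdge≡unique : ∀ q k {j W} → 2 ≤ arity (sub T (child q k)) → Unique (E (child q k)) W →
                            FullOfHeight (sub T (child (child q k) j)) 1 → (child q k , j) ≡ W
  height1-son⇒sonEdge≡unique q k {j} {W} 2≤ W-unique F with two-sons 2≤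
  ... | j₀ , j₁ , j₀≢j₁ with branching⇒repeated q k j₀≢j₁
  ... | α , rep = sym (height1-son⇒N-unique≡sonEdge (child q k) j F (proj₁ W-unique)
                        (other-color-unique (cf (child q k , j)) (repeated-⊎ʳ rep) (inj₂ (proj₁ W-unique))
                                             (unique-color≢ W-unique rep)))

-- For L = SonLevel T u, InFᵢ T u is AllSonsFull T u × Fᵢ.
module Profile {n : ℕ} (L : Fin n → ℕ → Set) where

  Some : ℕ → Set
  Some k = Σ (Fin n) λ j → L j k

  ExactlyOne : ℕ → Set
  ExactlyOne k = Σ (Fin n) λ j → L j k × ((j′ : Fin n) → L j′ k → j′ ≡ j)

  F₁ F₂ F₃ F₄ : Set
  F₁ = Some 2 × ExactlyOne 3 × ((j : Fin n) → L j 2 ⊎ L j 3)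
  F₂ = Some 2 × Some 4 × ((j : Fin n) → L j 2 ⊎ L j 4)
  F₃ = ExactlyOne 3 × Some 4 × ((j : Fin n) → L j 2 ⊎ L j 3 ⊎ L j 4)
  F₄ = ExactlyOne 5 × (Some 2 ⊎ Some 4) × ((j : Fin n) → L j 2 ⊎ L j 4 ⊎ L j 5)

  module Classification
    (ℓ : Fin n → ℕ) (fromℓ : ∀ {j k} → ℓ j ≡ k → L j k) (toℓ : ∀ {j k} → L j k → ℓ j ≡ k)
    (range       : ∀ j → ℓ j ≡ 2 ⊎ ℓ j ≡ 3 ⊎ ℓ j ≡ 4 ⊎ ℓ j ≡ 5)
    (unique-5    : ∀ {j j′} → ℓ j ≡ 5 → ℓ j′ ≡ 5 → j ≡ j′)
    (¬3-beside-5 : ∀ {j j′} → ℓ j ≡ 3 → ℓ j′ ≡ 5 → ⊥)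
    (unique-3    : ∀ {j j′ k} → ℓ j ≡ 3 → ℓ j′ ≡ 3 → ℓ k ≢ 3 → j ≡ j′)
    (nonConstant : ∀ k → ¬ (∀ j → ℓ j ≡ k))
    where

    some-≢ : ∀ k → Σ (Fin n) λ j → ℓ j ≢ k
    some-≢ k = ¬∀⟶∃¬ n _ (λ j → ℓ j ℕ.≟ k) (nonConstant k)

    exactlyOne : ∀ {j k} → ℓ j ≡ k → (∀ {j′} → ℓ j′ ≡ k → j′ ≡ j) → ExactlyOne k
    exactlyOne {j} e only = j , fromℓ e , λ j′ l → only (toℓ l)

    choose : ∀ {a b} → (∀ j → L j a ⊎ L j b) → Σ (Fin n) (λ j → ℓ j ≢ b) → Some a
    choose levels (j , ≢b) with levels j
    ... | inj₁ l = j , l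
    ... | inj₂ l = ⊥-elim (≢b (toℓ l))

    exactlyOne-3 : ∀ {j} → ℓ j ≡ 3 → ExactlyOne 3
    exactlyOne-3 e₃ = exactlyOne e₃ (λ e → unique-3 e e₃ (proj₂ (some-≢ 3)))

    classify : F₁ ⊎ F₂ ⊎ F₃ ⊎ F₄
    classify with any? (λ j → ℓ j ℕ.≟ 5) | any? (λ j → ℓ j ℕ.≟ 3) | any? (λ j → ℓ j ℕ.≟ 4)
    ... | yes (j₅ , e₅) | _ | _ =
      inj₂ (inj₂ (inj₂ (exactlyOne e₅ (λ e → unique-5 e e₅) , some-2-or-4 (some-≢ 5) , levels)))
      where
      levels : ∀ j → L j 2 ⊎ L j 4 ⊎ L j 5
      levels j with range j
      ... | inj₁ e               = inj₁ (fromℓ e)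
      ... | inj₂ (inj₁ e)        = ⊥-elim (¬3-beside-5 e e₅)
      ... | inj₂ (inj₂ (inj₁ e)) = inj₂ (inj₁ (fromℓ e))
      ... | inj₂ (inj₂ (inj₂ e)) = inj₂ (inj₂ (fromℓ e))
      some-2-or-4 : Σ (Fin n) (λ j → ℓ j ≢ 5) → Some 2 ⊎ Some 4
      some-2-or-4 (j , ≢5) with levels j
      ... | inj₁ l        = inj₁ (j , l)
      ... | inj₂ (inj₁ l) = inj₂ (j , l)
      ... | inj₂ (inj₂ l) = ⊥-elim (≢5 (toℓ l))
    ... | no ¬5 | yes (_ , e₃) | no ¬4 = inj₁ (choose levels (some-≢ 3) , exactlyOne-3 e₃ , levels)
      where
      levels : ∀ j → L j 2 ⊎ L j 3
      levels j with range j
      ... | inj₁ e               = inj₁ (fromℓ e)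
      ... | inj₂ (inj₁ e)        = inj₂ (fromℓ e)
      ... | inj₂ (inj₂ (inj₁ e)) = ⊥-elim (¬4 (j , e))
      ... | inj₂ (inj₂ (inj₂ e)) = ⊥-elim (¬5 (j , e))
    ... | no ¬5 | no ¬3 | _ =
      inj₂ (inj₁ (choose levels (some-≢ 4) , choose (swap ∘ levels) (some-≢ 2) , levels))
      where
      levels : ∀ j → L j 2 ⊎ L j 4
      levels j with range j
      ... | inj₁ e               = inj₁ (fromℓ e)
      ... | inj₂ (inj₁ e)        = ⊥-elim (¬3 (j , e))
      ... | inj₂ (inj₂ (inj₁ e)) = inj₂ (fromℓ e)
      ... | inj₂ (inj₂ (inj₂ e)) = ⊥-elim (¬5 (j , e))
    ... | no ¬5 | yes (_ , e₃) | yes (j₄ , e₄) =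
      inj₂ (inj₂ (inj₁ (exactlyOne-3 e₃ , (j₄ , fromℓ e₄) , levels)))
      where
      levels : ∀ j → L j 2 ⊎ L j 3 ⊎ L j 4
      levels j with range j
      ... | inj₁ e               = inj₁ (fromℓ e)
      ... | inj₂ (inj₁ e)        = inj₂ (inj₁ (fromℓ e))
      ... | inj₂ (inj₂ (inj₁ e)) = inj₂ (inj₂ (fromℓ e))
      ... | inj₂ (inj₂ (inj₂ e)) = ⊥-elim (¬5 (j , e))

module BranchingVertex (T : Tree) (c : Edge T → Fin 2) (cf : IsCFColoring T 2 c)
  (q : Pos T) (k : Fin (arity (sub T q))) (2≤ : 2 ≤ arity (sub T (child q k)))
  (sons-full : AllSonsFull T (child q k)) (¬full : ¬ Full (SubT T (child q k))) where

  open TwoColoring T c cf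
  open Profile (SonLevel T (child q k))

  x = child q k

  height : Fin (arity (sub T x)) → ℕ
  height j = proj₁ (full⇒height (sons-full j))

  son-full : ∀ j → FullOfHeight (sub T (child x j)) (height j)
  son-full j = proj₂ (full⇒height (sons-full j))

  ℓ : Fin (arity (sub T x)) → ℕ
  ℓ j = 2 + height j

  fromℓ : ∀ {j l} → ℓ j ≡ l → SonLevel T x j l
  fromℓ {j} e = suc (height j) , fullOfHeight⇒fullWith (son-full j) , sym e

  toℓ : ∀ {j l} → SonLevel T x j l → ℓ j ≡ l
  toℓ {j} (suc h , F , refl) = cong (2 +_) (fullOfHeight-unique (son-full j) (fullWith⇒fullOfHeight F))

  son-of-height : ∀ j {h} → ℓ j ≡ 2 + h → FullOfHeight (sub T (child x j)) h
  son-of-height j e = subst (FullOfHeight (sub T (child x j))) (suc-injective (suc-injective e)) (son-full j)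

  range : ∀ j → ℓ j ≡ 2 ⊎ ℓ j ≡ 3 ⊎ ℓ j ≡ 4 ⊎ ℓ j ≡ 5
  range j = bounded (height j) (son-full j)
    where
    bounded : ∀ h → FullOfHeight (sub T (child x j)) h → 2 + h ≡ 2 ⊎ 2 + h ≡ 3 ⊎ 2 + h ≡ 4 ⊎ 2 + h ≡ 5
    bounded 0 _ = inj₁ refl
    bounded 1 _ = inj₂ (inj₁ refl)
    bounded 2 _ = inj₂ (inj₂ (inj₁ refl))
    bounded 3 _ = inj₂ (inj₂ (inj₂ refl))
    bounded (suc (suc (suc (suc h)))) F = ⊥-elim (¬height≥4 x j h F)

  unique-5 : ∀ {j j′} → ℓ j ≡ 5 → ℓ j′ ≡ 5 → j ≡ j′
  unique-5 {j} {j′} e e′ = uniqueSonEdges-equal q k (height3-son⇒unique x j (son-of-height j e))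
                                                    (height3-son⇒unique x j′ (son-of-height j′ e′))

  ¬3-beside-5 : ∀ {j j′} → ℓ j ≡ 3 → ℓ j′ ≡ 5 → ⊥
  ¬3-beside-5 {j} {j′} e₃ e₅ = 3≢5 (trans (sym e₃) (trans (cong ℓ same-son) e₅))
    where
    same-son : j ≡ j′
    same-son = sonEdge-injective (height1-son⇒sonEdge≡unique q k 2≤
                 (height3-son⇒unique x j′ (son-of-height j′ e₅)) (son-of-height j e₃))
    3≢5 : 3 ≢ 5
    3≢5 ()

  unique-at-non-3 : ∀ i → ℓ i ≢ 3 → ∃ (Unique (E x))
  unique-at-non-3 i ≢3 with range i
  ... | inj₁ e               = leaf-son⇒unique x i (son-of-height i e)
  ... | inj₂ (inj₁ e)        = ⊥-elim (≢3 e)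
  ... | inj₂ (inj₂ (inj₁ e)) = let (g , g-unique , _) = height2-son⇒unique x i (son-of-height i e)
                               in  g , g-unique
  ... | inj₂ (inj₂ (inj₂ e)) = (x , i) , height3-son⇒unique x i (son-of-height i e)

  unique-3 : ∀ {j j′ i} → ℓ j ≡ 3 → ℓ j′ ≡ 3 → ℓ i ≢ 3 → j ≡ j′
  unique-3 {j} {j′} {i} e e′ ≢3 with unique-at-non-3 i ≢3
  ... | W , W-unique = sonEdge-injective (trans (absorbed e) (sym (absorbed e′)))
    where
    absorbed : ∀ {j} → ℓ j ≡ 3 → (x , j) ≡ W
    absorbed {j} e = height1-son⇒sonEdge≡unique q k 2≤ W-unique (son-of-height j e)

  nonConstant : ∀ l → ¬ (∀ j → ℓ j ≡ l)
  nonConstant l constant with two-sons 2≤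
  ... | j₀ , _ = ¬full (height⇒full (suc (height j₀) , 2≤ , sons))
    where
    sons : ∀ j → FullOfHeight (son (sub T x) j) (height j₀)
    sons j = subst (λ t → FullOfHeight t (height j₀)) (sub-child x j)
                   (son-of-height j (trans (constant j) (sym (constant j₀))))

  classification : F₁ ⊎ F₂ ⊎ F₃ ⊎ F₄
  classification = Classification.classify ℓ fromℓ toℓ range unique-5 ¬3-beside-5 unique-3 nonConstant

  inF : InF1 T x ⊎ InF2 T x ⊎ InF3 T x ⊎ InF4 T x
  inF = Sum.map (sons-full ,_) (Sum.map (sons-full ,_) (Sum.map (sons-full ,_) (sons-full ,_))) classification

twoColoring⇒surficial∈F : ∀ T → Complete T → HasCFColoring T 2 → ∀ {u} → Surficial T u →
              InF1 T u ⊎ InF2 T u ⊎ InF3 T u ⊎ InF4 T u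
twoColoring⇒surficial∈F T (_ , branching) (c , cf) {u} surficial@((j , _ , u≢here , ¬full) , _)
  with here-or-child u
... | inj₁ refl = ⊥-elim (u≢here refl)
... | inj₂ ((q , k) , refl) with branching u u≢here
...   | inj₁ leaf = ⊥-elim (¬Fin0 (subst Fin leaf j))
...   | inj₂ 2≤   = BranchingVertex.inF T c cf q k 2≤ (surficial⇒sonsFull T surficial) ¬full

corollary1 : (T : Tree) → Complete T → ¬ FullTree T →
    (u : Pos T) → Surficial T u →
    ¬ (InF1 T u ⊎ InF2 T u ⊎ InF3 T u ⊎ InF4 T u) →
    CFChromaticIndexIs T 3
corollary1 T complete _ u surficial ∉F =
  (depthColoring T , depthColoring-cf T (proj₁ complete)) ,
  λ j j<3 coloring →
    ∉F (twoColoring⇒surficial∈F T complete (hasCFColoring-mono (ℕ.≤-pred j<3) coloring) surficial)
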